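{- For every positive integer $n$, $$\mathcal{OSG}(2n)=\mathcal{ESG}(2n)+G((0)_{2n-2}\cdot(1))=\{G+G((0)_{2n-2}\cdot(1)) : G\in\mathcal{ESG}(2n)\}.$$
   Context: For a binary sequence $S=(s_1,\dots,s_{m-1})$, the Steinhaus graph $G(S)$ is the simple graph on $v_1,\dots,v_m$ whose adjacency matrix $(a_{i,j})$ is symmetric with zero diagonal, has $a_{1,j}=s_{j-1}$ for $2\le j\le m$, and satisfies $a_{i,j}\equiv a_{i-1,j-1}+a_{i-1,j}\pmod 2$ for $2\le i<j\le m$. Addition of Steinhaus graphs is $G(S)+G(T)=G(S+T)$, with sequences added termwise mod 2. $\mathcal{ESG}(m)$ denotes the set of Steinhaus graphs of order $m$ all of whose vertex degrees are even. $\mathcal{OSG}(m)$ denotes the set of those all of whose vertex degrees are odd. $(x)_k$ is the constant sequence of length $k$ equal to $x$, and $\cdot$ denotes concatenation. -}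

module Defs where

open import Data.Nat using (ℕ; zero; suc; _+_; _*_; _∸_)
import Data.Nat
import Relation.Nullary
import Data.Fin
import Data.Bool
open import Data.Bool using (Bool; true; false; _xor_; if_then_else_)
open import Data.Fin using (Fin; toℕ; _≟_)
open import Data.Vec using (Vec; _∷_; []; lookup; zipWith; replicate; _++_; [_])
open import Data.List using (List; length; filter)
open import Data.List using () renaming (allFin to allFinL)
open import Data.Nat.DivMod using (_%_)
open import Data.Product using (Σ; ∃; _×_)
open import Relation.Binary.PropositionalEquality using (_≡_)
open import Relation.Nullary using (¬_)
open import Relation.Nullary.Decidable using (⌊_⌋)

-- A binary sequence of length k = (s_1,…,s_k); Steinhaus graph of order m = k+1.
BinSeq : ℕ → Set
BinSeq k = Vec Bool k

Graph : ℕ → Set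
Graph m = Fin m → Fin m → Bool

-- Upper-triangular entries, 0-indexed: vertex v_{i+1} ↔ index i.
-- entry S i j  is  a_{i+1,j+1}  for  i < j  (j as ℕ index < k+1).
-- a_{1,j} = s_{j-1};  a_{i,j} = a_{i-1,j-1} + a_{i-1,j}  (mod 2).
entry : ∀ {k} → BinSeq k → ℕ → ℕ → Bool
entry s zero zero = false
entry {k} s zero (suc j) with Data.Nat._<?_ j k
... | Relation.Nullary.yes j<k = lookup s (Data.Fin.fromℕ< j<k)
... | Relation.Nullary.no _ = false
entry s (suc i) zero = false
entry s (suc i) (suc j) = entry s i j xor entry s i (suc j)

steinhaus : ∀ {k} → BinSeq k → Graph (suc k)
steinhaus s i j with Data.Nat._<?_ (toℕ i) (toℕ j) | Data.Nat._<?_ (toℕ j) (toℕ i)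
... | Relation.Nullary.yes _ | _ = entry s (toℕ i) (toℕ j)
... | Relation.Nullary.no _ | Relation.Nullary.yes _ = entry s (toℕ j) (toℕ i)
... | Relation.Nullary.no _ | Relation.Nullary.no _ = false

degree : ∀ {m} → Graph m → Fin m → ℕ
degree {m} G i = length (filter (λ j → G i j Data.Bool.≟ true) (allFinL m))

_≐_ : ∀ {m} → Graph m → Graph m → Set
G ≐ H = ∀ i j → G i j ≡ H i j

Even : ℕ → Set
Even d = d % 2 ≡ 0

Odd : ℕ → Set
Odd d = d % 2 ≡ 1

_⊕_ : ∀ {k} → BinSeq k → BinSeq k → BinSeq k
_⊕_ = zipWith _xor_

-- G is a Steinhaus graph of order suc k all of whose degrees are even / odd.
-- ESG(k+1) and OSG(k+1) as predicates on graphs of order k+1.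
InESG : ∀ k → Graph (suc k) → Set
InESG k G = Σ (BinSeq k) (λ S → (G ≐ steinhaus S)) × (∀ v → Even (degree G v))

InOSG : ∀ k → Graph (suc k) → Set
InOSG k G = Σ (BinSeq k) (λ S → (G ≐ steinhaus S)) × (∀ v → Odd (degree G v))

zerosOne : ∀ k → BinSeq (suc k)
zerosOne zero = true ∷ []
zerosOne (suc k) = false ∷ zerosOne k

module Submission where

-- Write z = (0)_{2n}·(1).  The proof rests on three facts.
--   (1) Linearity: G(S ⊕ T) = G(S) + G(T) entrywise (mod 2), since the
--       Steinhaus recurrence is linear over GF(2).
--   (2) Degree parity is linear: the parity of deg_G(v) is the xor of the
--       row of v, so par deg_{G(S⊕T)}(v) = par deg_{G(S)}(v) xor par deg_{G(T)}(v).
--   (3) G(z) is the star centred at the last vertex: a_{i,j} = [i last] xor [j last].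
--       In order 2n+2 every vertex therefore has odd degree (1 or 2n+1).
-- Hence adding G(z) flips the parity of every degree, and since z ⊕ z = 0
-- the map G ↦ G + G(z) exchanges ESG(2n+2) and OSG(2n+2).

open import Defs
open import Data.Nat using (ℕ; suc; _*_; _+_)
open import Data.Product using (Σ; _×_)
open import Function.Bundles using (_⇔_)

open import Algebra.Bundles using (CommutativeRing)
open import Data.Bool using (Bool; true; false; not; _∧_; _xor_; if_then_else_)
import Data.Bool
open import Data.Bool.Properties
  using (xor-∧-commutativeRing; xor-same; xor-identityʳ; xor-assoc; xor-comm; not-involutive; ∧-zeroʳ)
open import Data.Empty using (⊥-elim)
open import Data.Fin using (Fin; toℕ; fromℕ<) renaming (zero to fzero; suc to fsuc)
open import Data.Fin.Properties using (toℕ≤pred[n])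
open import Data.List using (length; filter; tabulate)
open import Data.Nat using (zero; _≤_; _<_; _<?_; _≡ᵇ_; s≤s; _%_)
open import Data.Nat.Properties using (≤-trans; ≤-refl; n≤1+n; ≤-antisym; ≮⇒≥; +-suc)
open import Data.Product using (_,_)
open import Data.Vec using ([]; _∷_; lookup)
open import Data.Vec.Properties using (lookup-zipWith)
open import Function using (_∘_; id)
open import Function.Bundles using (mk⇔)
open import Relation.Binary.PropositionalEquality
open import Relation.Nullary using (yes; no)

open import Algebra.Properties.CommutativeSemigroup
  (CommutativeRing.+-commutativeSemigroup xor-∧-commutativeRing)
  using () renaming (interchange to xor-interchange)

⊕-cancelʳ : ∀ {k} (S T : BinSeq k) → (S ⊕ T) ⊕ T ≡ S
⊕-cancelʳ []      []      = refl
⊕-cancelʳ (a ∷ S) (b ∷ T) =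
  cong₂ _∷_ (trans (xor-assoc a b b) (trans (cong (a xor_) (xor-same b)) (xor-identityʳ a)))
            (⊕-cancelʳ S T)

-- Every entry of the triangle is linear in the generating sequence,
-- because the first row is and the recurrence is a sum mod 2.
entry-⊕ : ∀ {k} (S T : BinSeq k) i j →
          entry (S ⊕ T) i j ≡ entry S i j xor entry T i j
entry-⊕ S T zero zero = refl
entry-⊕ {k} S T zero (suc j) with j <? k
... | yes j<k = lookup-zipWith _xor_ (fromℕ< j<k) S T
... | no _    = refl
entry-⊕ S T (suc i) zero = refl
entry-⊕ S T (suc i) (suc j)
  rewrite entry-⊕ S T i j | entry-⊕ S T i (suc j) =
  xor-interchange (entry S i j) (entry T i j) (entry S i (suc j)) (entry T i (suc j))

steinhaus-⊕ : ∀ {k} (S T : BinSeq k) i j →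
              steinhaus (S ⊕ T) i j ≡ steinhaus S i j xor steinhaus T i j
steinhaus-⊕ S T i j with toℕ i <? toℕ j | toℕ j <? toℕ i
... | yes _ | _     = entry-⊕ S T (toℕ i) (toℕ j)
... | no _  | yes _ = entry-⊕ S T (toℕ j) (toℕ i)
... | no _  | no _  = refl

isOdd : ℕ → Bool
isOdd zero    = false
isOdd (suc d) = not (isOdd d)

xorSum : ∀ {m} → (Fin m → Bool) → Bool
xorSum {zero}  f = false
xorSum {suc m} f = f fzero xor xorSum (f ∘ fsuc)

xorSum-cong : ∀ {m} {f g : Fin m → Bool} → (∀ j → f j ≡ g j) → xorSum f ≡ xorSum g
xorSum-cong {zero}  f≗g = refl
xorSum-cong {suc m} f≗g = cong₂ _xor_ (f≗g fzero) (xorSum-cong (f≗g ∘ fsuc))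

xorSum-xor : ∀ {m} (f g : Fin m → Bool) → xorSum (λ j → f j xor g j) ≡ xorSum f xor xorSum g
xorSum-xor {zero}  f g = refl
xorSum-xor {suc m} f g rewrite xorSum-xor (f ∘ fsuc) (g ∘ fsuc) =
  xor-interchange (f fzero) (g fzero) (xorSum (f ∘ fsuc)) (xorSum (g ∘ fsuc))

xorSum-const : ∀ m c → xorSum {m} (λ _ → c) ≡ c ∧ isOdd m
xorSum-const zero    false = refl
xorSum-const zero    true  = refl
xorSum-const (suc m) false = xorSum-const m false
xorSum-const (suc m) true  = cong not (xorSum-const m true)

xorSum-indicator : ∀ m t → t < m → xorSum {m} (λ j → toℕ j ≡ᵇ t) ≡ true
xorSum-indicator (suc m) zero    _         = cong not (xorSum-const m false)
xorSum-indicator (suc m) (suc t) (s≤s t<m) = xorSum-indicator m t t<m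

-- Counting the `true` entries of a row has the parity of its xor-sum
-- (stated for rows reindexed by any g, so that the induction goes through).
isOdd-countTrue : ∀ m {M} (g : Fin m → Fin M) (f : Fin M → Bool) →
  isOdd (length (filter (λ j → f j Data.Bool.≟ true) (tabulate g))) ≡ xorSum (f ∘ g)
isOdd-countTrue zero    g f = refl
isOdd-countTrue (suc m) g f with f (g fzero) | isOdd-countTrue m (g ∘ fsuc) f
... | true  | ih = cong not ih
... | false | ih = ih

isOdd-degree : ∀ {m} (G : Graph m) v → isOdd (degree G v) ≡ xorSum (G v)
isOdd-degree {m} G v = isOdd-countTrue m id (G v)

isOdd-degree-≐ : ∀ {m} {G H : Graph m} → G ≐ H → ∀ v → isOdd (degree G v) ≡ isOdd (degree H v)
isOdd-degree-≐ {G = G} {H} G≐H v =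
  trans (isOdd-degree G v) (trans (xorSum-cong (G≐H v)) (sym (isOdd-degree H v)))

isOdd-degree-⊕ : ∀ {k} (S T : BinSeq k) v →
  isOdd (degree (steinhaus (S ⊕ T)) v)
    ≡ isOdd (degree (steinhaus S) v) xor isOdd (degree (steinhaus T) v)
isOdd-degree-⊕ S T v = begin
  isOdd (degree (steinhaus (S ⊕ T)) v)             ≡⟨ isOdd-degree (steinhaus (S ⊕ T)) v ⟩
  xorSum (steinhaus (S ⊕ T) v)                     ≡⟨ xorSum-cong (steinhaus-⊕ S T v) ⟩
  xorSum (λ j → steinhaus S v j xor steinhaus T v j) ≡⟨ xorSum-xor (steinhaus S v) (steinhaus T v) ⟩
  xorSum (steinhaus S v) xor xorSum (steinhaus T v)
    ≡⟨ sym (cong₂ _xor_ (isOdd-degree (steinhaus S) v) (isOdd-degree (steinhaus T) v)) ⟩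
  isOdd (degree (steinhaus S) v) xor isOdd (degree (steinhaus T) v) ∎
  where open ≡-Reasoning

-- Translation between the Boolean parity and the predicates Even/Odd.
-- `(2 + d) % 2` reduces to `d % 2` by computation.
%2-isOdd : ∀ d → d % 2 ≡ (if isOdd d then 1 else 0)
%2-isOdd zero          = refl
%2-isOdd (suc zero)    = refl
%2-isOdd (suc (suc d)) rewrite not-involutive (isOdd d) = %2-isOdd d

Even⇒¬isOdd : ∀ d → Even d → isOdd d ≡ false
Even⇒¬isOdd d even with isOdd d | %2-isOdd d
... | false | _     = refl
... | true  | d%2≡1 with trans (sym even) d%2≡1
...   | ()

Odd⇒isOdd : ∀ d → Odd d → isOdd d ≡ true
Odd⇒isOdd d odd with isOdd d | %2-isOdd d
... | true  | _     = refl
... | false | d%2≡0 with trans (sym odd) d%2≡0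
...   | ()

¬isOdd⇒Even : ∀ d → isOdd d ≡ false → Even d
¬isOdd⇒Even d p = trans (%2-isOdd d) (cong (if_then 1 else 0) p)

isOdd⇒Odd : ∀ d → isOdd d ≡ true → Odd d
isOdd⇒Odd d p = trans (%2-isOdd d) (cong (if_then 1 else 0) p)

<⇒≡ᵇ-false : ∀ {m n} → m < n → (m ≡ᵇ n) ≡ false
<⇒≡ᵇ-false {zero}  {suc n} _         = refl
<⇒≡ᵇ-false {suc m} {suc n} (s≤s m<n) = <⇒≡ᵇ-false m<n

lookup-zerosOne : ∀ k j (j<1+k : j < suc k) → lookup (zerosOne k) (fromℕ< j<1+k) ≡ (j ≡ᵇ k)
lookup-zerosOne zero    zero    _         = refl
lookup-zerosOne zero    (suc j) (s≤s ())
lookup-zerosOne (suc k) zero    _         = refl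
lookup-zerosOne (suc k) (suc j) (s≤s j<k) = lookup-zerosOne k j j<k

-- In the triangle of (0)_k · (1), the entry a_{i,j} (i < j) is 1 exactly in
-- the last column: each row is the previous one, since a_{i,last-1} = 0.
entry-zerosOne : ∀ k i j → i < j → j ≤ suc k → entry (zerosOne k) i j ≡ (j ≡ᵇ suc k)
entry-zerosOne k zero (suc j) _ j<1+k with j <? suc k
... | yes j<1+k′ = lookup-zerosOne k j j<1+k′
... | no  j≮1+k  = ⊥-elim (j≮1+k j<1+k)
entry-zerosOne k (suc i) (suc j) (s≤s i<j) j<1+k
  rewrite entry-zerosOne k i j i<j (≤-trans (n≤1+n _) j<1+k)
        | entry-zerosOne k i (suc j) (≤-trans i<j (n≤1+n _)) j<1+k
        | <⇒≡ᵇ-false j<1+k = refl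

steinhaus-zerosOne : ∀ k (v j : Fin (suc (suc k))) →
  steinhaus (zerosOne k) v j ≡ (toℕ v ≡ᵇ suc k) xor (toℕ j ≡ᵇ suc k)
steinhaus-zerosOne k v j with toℕ v <? toℕ j | toℕ j <? toℕ v
... | yes v<j | _ rewrite <⇒≡ᵇ-false (≤-trans v<j (toℕ≤pred[n] j)) =
  entry-zerosOne k (toℕ v) (toℕ j) v<j (toℕ≤pred[n] j)
... | no _ | yes j<v rewrite <⇒≡ᵇ-false (≤-trans j<v (toℕ≤pred[n] v)) =
  trans (entry-zerosOne k (toℕ j) (toℕ v) j<v (toℕ≤pred[n] v)) (sym (xor-identityʳ _))
... | no v≮j | no j≮v rewrite ≤-antisym (≮⇒≥ j≮v) (≮⇒≥ v≮j) = sym (xor-same (toℕ j ≡ᵇ suc k))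

isOdd-double : ∀ n → isOdd (2 * n) ≡ false
isOdd-double zero    = refl
isOdd-double (suc n) rewrite +-suc n (n + 0) | not-involutive (isOdd (n + (n + 0))) = isOdd-double n

star-oddDegree : ∀ n v → isOdd (degree (steinhaus (zerosOne (2 * n))) v) ≡ true
star-oddDegree n v = begin
  isOdd (degree (steinhaus z) v)                        ≡⟨ isOdd-degree (steinhaus z) v ⟩
  xorSum (steinhaus z v)                                ≡⟨ xorSum-cong (steinhaus-zerosOne (2 * n) v) ⟩
  xorSum (λ j → isCentre v xor isCentre j)              ≡⟨ xorSum-xor (λ _ → isCentre v) isCentre ⟩
  xorSum {m} (λ _ → isCentre v) xor xorSum isCentre     ≡⟨ cong₂ _xor_ (xorSum-const m (isCentre v))
                                                                        (xorSum-indicator m (suc (2 * n)) ≤-refl) ⟩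
  (isCentre v ∧ isOdd m) xor true                       ≡⟨ cong (λ b → (isCentre v ∧ b) xor true)
                                                                (trans (not-involutive _) (isOdd-double n)) ⟩
  (isCentre v ∧ false) xor true                         ≡⟨ cong (_xor true) (∧-zeroʳ (isCentre v)) ⟩
  true                                                  ∎
  where
  open ≡-Reasoning
  m = suc (suc (2 * n))
  z = zerosOne (2 * n)
  isCentre : Fin m → Bool
  isCentre j = toℕ j ≡ᵇ suc (2 * n)

isOdd-degree-shift : ∀ n (S : BinSeq (suc (2 * n))) v →
  isOdd (degree (steinhaus (S ⊕ zerosOne (2 * n))) v) ≡ not (isOdd (degree (steinhaus S) v))
isOdd-degree-shift n S v =
  trans (isOdd-degree-⊕ S (zerosOne (2 * n)) v)
        (trans (cong (isOdd (degree (steinhaus S) v) xor_) (star-oddDegree n v))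
               (xor-comm _ true))

mainTheorem5 : (n : ℕ) → (G : Graph (suc (suc (2 * n)))) → InOSG (suc (2 * n)) G ⇔ Σ (BinSeq (suc (2 * n))) (λ T → InESG (suc (2 * n)) (steinhaus T) × (G ≐ steinhaus (T ⊕ zerosOne (2 * n))))
mainTheorem5 n G = mk⇔ odd⇒evenShifted evenShifted⇒odd
  where
  z = zerosOne (2 * n)

  -- G = G(S) odd  ⇒  G(S ⊕ z) is even, and G = G(S ⊕ z) + G(z) since z ⊕ z = 0.
  odd⇒evenShifted : InOSG (suc (2 * n)) G →
    Σ (BinSeq (suc (2 * n))) (λ T → InESG (suc (2 * n)) (steinhaus T) × (G ≐ steinhaus (T ⊕ z)))
  odd⇒evenShifted ((S , G≐S) , odd) = S ⊕ z , ((S ⊕ z , λ _ _ → refl) , even) , G≐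
    where
    even : ∀ v → Even (degree (steinhaus (S ⊕ z)) v)
    even v = ¬isOdd⇒Even (degree (steinhaus (S ⊕ z)) v) (trans (isOdd-degree-shift n S v)
      (cong not (trans (sym (isOdd-degree-≐ G≐S v)) (Odd⇒isOdd (degree G v) (odd v)))))
    G≐ : G ≐ steinhaus ((S ⊕ z) ⊕ z)
    G≐ i j = trans (G≐S i j) (cong (λ X → steinhaus X i j) (sym (⊕-cancelʳ S z)))

  evenShifted⇒odd : Σ (BinSeq (suc (2 * n))) (λ T → InESG (suc (2 * n)) (steinhaus T) × (G ≐ steinhaus (T ⊕ z))) →
    InOSG (suc (2 * n)) G
  evenShifted⇒odd (T , ((_ , even) , G≐)) = (T ⊕ z , G≐) , odd
    where
    odd : ∀ v → Odd (degree G v)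
    odd v = isOdd⇒Odd (degree G v) (trans (isOdd-degree-≐ G≐ v) (trans (isOdd-degree-shift n T v)
      (cong not (Even⇒¬isOdd (degree (steinhaus T) v) (even v)))))
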